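{- Let $A$ be a DLCMI and $a\in A$. Then $(1\to a)^n\le 1\to a^n$ for every natural number $n$.
   Context: A DLCMI is an algebra $(A,\wedge,\vee,\cdot,\to,1)$ of type $(2,2,2,2,0)$ such that for all $a,b,c\in A$: (1) $(A,\wedge,\vee)$ is a distributive lattice; (2) $1$ is the largest element; (3) $(A,\cdot,1)$ is a commutative monoid; (4) $(a\to b)\wedge(a\to c)=a\to(b\wedge c)$; (5) $(a\to c)\wedge(b\to c)=(a\vee b)\to c$; (6) $a\to a=1$; (7) $(a\vee b)\cdot c=(a\cdot c)\vee(b\cdot c)$; (8) $(a\to b)\cdot(b\to c)\le a\to c$; (9) $a\to b\le (a\cdot c)\to(b\cdot c)$. Powers: $x^0=1$, $x^n=x\cdot x^{n-1}$. -}

module Defs where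

open import Level using (Level; suc)
open import Data.Nat using (ℕ; zero; suc)
open import Relation.Binary.PropositionalEquality using (_≡_)
open import Algebra.Core using (Op₂)
open import Algebra.Lattice.Structures using (IsDistributiveLattice)
open import Algebra.Structures using (IsCommutativeMonoid)

-- A DLCMI (distributive lattice with a commutative monoid and an implication),
-- with equality taken to be propositional equality on the carrier.
record DLCMI (c : Level) : Set (Level.suc c) where
  infixr 5 _→ᵈ_
  infixl 7 _·_
  infixr 6 _∧_
  infixr 6 _∨_
  field
    Carrier : Set c
    _∧_ _∨_ _·_ _→ᵈ_ : Op₂ Carrier
    𝟏 : Carrier

  _≤_ : Carrier → Carrier → Set c
  a ≤ b = (a ∧ b) ≡ a

  field
    isDistributiveLattice : IsDistributiveLattice _≡_ _∨_ _∧_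
    ≤-𝟏 : ∀ a → a ≤ 𝟏
    isCommutativeMonoid : IsCommutativeMonoid _≡_ _·_ 𝟏
    →-∧ʳ : ∀ a b c → ((a →ᵈ b) ∧ (a →ᵈ c)) ≡ (a →ᵈ (b ∧ c))
    →-∨ˡ : ∀ a b c → ((a →ᵈ c) ∧ (b →ᵈ c)) ≡ ((a ∨ b) →ᵈ c)
    →-refl : ∀ a → (a →ᵈ a) ≡ 𝟏
    -- (7)
    ·-distribʳ-∨ : ∀ a b c → ((a ∨ b) · c) ≡ ((a · c) ∨ (b · c))
    -- (8)
    →-trans : ∀ a b c → ((a →ᵈ b) · (b →ᵈ c)) ≤ (a →ᵈ c)
    -- (9)
    →-mono-· : ∀ a b c → (a →ᵈ b) ≤ ((a · c) →ᵈ (b · c))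

  _^_ : Carrier → ℕ → Carrier
  x ^ zero = 𝟏
  x ^ suc n = x · (x ^ n)

-- The map x ↦ 1 → x is submultiplicative: by (9) with 1·b = b we have 1 → a ≤ b → a·b, and
-- composing with 1 → b via (8) gives (1 → a)·(1 → b) ≤ 1 → a·b. Induction on n, using that
-- multiplication is monotone (a consequence of (7)), then yields the claim.
module Submission where

open import Defs
open import Level using (Level)
open import Data.Nat using (ℕ; zero; suc)
open import Relation.Binary.PropositionalEquality using (_≡_; cong; subst; subst₂; sym; trans; module ≡-Reasoning)
open import Algebra.Lattice.Structures using (IsDistributiveLattice)
open import Algebra.Structures using (IsCommutativeMonoid)

module DLCMI-Properties {c : Level} (A : DLCMI c) where
  open DLCMI A
  open IsDistributiveLattice isDistributiveLattice
    using (∧-comm; ∧-assoc; ∨-comm; ∨-absorbs-∧; ∧-absorbs-∨)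
  open IsCommutativeMonoid isCommutativeMonoid
    using (identityˡ) renaming (comm to ·-comm)
  open ≡-Reasoning

  ≤-trans : ∀ {x y z} → x ≤ y → y ≤ z → x ≤ z
  ≤-trans {x} {y} {z} x≤y y≤z = begin
    x ∧ z        ≡⟨ cong (_∧ z) (sym x≤y) ⟩
    (x ∧ y) ∧ z  ≡⟨ ∧-assoc x y z ⟩
    x ∧ (y ∧ z)  ≡⟨ cong (x ∧_) y≤z ⟩
    x ∧ y        ≡⟨ x≤y ⟩
    x            ∎

  ≤⇒∨≡ : ∀ {x y} → x ≤ y → x ∨ y ≡ y
  ≤⇒∨≡ {x} {y} x≤y = begin
    x ∨ y        ≡⟨ cong (_∨ y) (sym x≤y) ⟩
    (x ∧ y) ∨ y  ≡⟨ ∨-comm (x ∧ y) y ⟩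
    y ∨ (x ∧ y)  ≡⟨ cong (y ∨_) (∧-comm x y) ⟩
    y ∨ (y ∧ x)  ≡⟨ ∨-absorbs-∧ y x ⟩
    y            ∎

  ·-monoˡ-≤ : ∀ {x y} z → x ≤ y → (x · z) ≤ (y · z)
  ·-monoˡ-≤ {x} {y} z x≤y = begin
    (x · z) ∧ (y · z)              ≡⟨ cong (λ w → (x · z) ∧ (w · z)) (sym (≤⇒∨≡ x≤y)) ⟩
    (x · z) ∧ ((x ∨ y) · z)        ≡⟨ cong ((x · z) ∧_) (·-distribʳ-∨ x y z) ⟩
    (x · z) ∧ ((x · z) ∨ (y · z))  ≡⟨ ∧-absorbs-∨ (x · z) (y · z) ⟩
    x · z                          ∎

  ·-monoʳ-≤ : ∀ {x y} z → x ≤ y → (z · x) ≤ (z · y)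
  ·-monoʳ-≤ {x} {y} z x≤y =
    subst₂ _≤_ (·-comm x z) (·-comm y z) (·-monoˡ-≤ z x≤y)

  𝟏≤𝟏→𝟏 : 𝟏 ≤ (𝟏 →ᵈ 𝟏)
  𝟏≤𝟏→𝟏 = trans (cong (𝟏 ∧_) (→-refl 𝟏)) (≤-𝟏 𝟏)

  𝟏→-≤-→· : ∀ a b → (𝟏 →ᵈ a) ≤ (b →ᵈ a · b)
  𝟏→-≤-→· a b = subst (λ x → (𝟏 →ᵈ a) ≤ (x →ᵈ a · b)) (identityˡ b) (→-mono-· 𝟏 a b)

  𝟏→-submultiplicative : ∀ a b → ((𝟏 →ᵈ a) · (𝟏 →ᵈ b)) ≤ (𝟏 →ᵈ a · b)
  𝟏→-submultiplicative a b = ≤-trans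
    (subst (_≤ ((𝟏 →ᵈ b) · (b →ᵈ a · b))) (·-comm (𝟏 →ᵈ b) (𝟏 →ᵈ a))
      (·-monoʳ-≤ (𝟏 →ᵈ b) (𝟏→-≤-→· a b)))
    (→-trans 𝟏 b (a · b))

  𝟏→-^ : ∀ a n → ((𝟏 →ᵈ a) ^ n) ≤ (𝟏 →ᵈ (a ^ n))
  𝟏→-^ a zero    = 𝟏≤𝟏→𝟏
  𝟏→-^ a (suc n) = ≤-trans
    (·-monoʳ-≤ (𝟏 →ᵈ a) (𝟏→-^ a n))
    (𝟏→-submultiplicative a (a ^ n))

lemma3p7 : ∀ {c : Level} (A : DLCMI c) → let open DLCMI A in
    ∀ (a : Carrier) (n : ℕ) → ((𝟏 →ᵈ a) ^ n) ≤ (𝟏 →ᵈ (a ^ n))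
lemma3p7 A = DLCMI-Properties.𝟏→-^ A
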